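{- $[\tau(\mathbf{CInd})\mathbf{Txt}\mathbf{Psd}\mathbf{Ex}_C]_{\mathbf{REC}} \setminus [\mathbf{Txt}\mathbf{Sd}\mathbf{Bc}_W]_{\mathbf{REC}} \neq \emptyset$.
   Context: Fix an acceptable numbering $(\varphi_e)_{e\in\mathbb{N}}$ of all partial computable functions. $W_e=\mathrm{dom}(\varphi_e)$. A number $e$ is a $C$-index if $\varphi_e$ is total with values in $\{0,1\}$; then $C_e=\{x:\varphi_e(x)=1\}$. $\mathbf{REC}$ is the collection of recursive subsets of $\mathbb{N}$; $\mathcal{P}$ denotes the partial computable functions. Fix a pause symbol $\#$. A text is a total function $T:\mathbb{N}\to\mathbb{N}\cup\{\#\}$, $\mathrm{content}(T)=\mathrm{range}(T)\setminus\{\#\}$, $T$ is a text for $L$ if $\mathrm{content}(T)=L$, $T[n]=(T(0),\dots,T(n-1))$. A learner is some $h\in\mathcal{P}$ (finite sets coded as numbers). Hypothesis sequences: partially set-driven $\mathbf{Psd}(h,T)(i)=h(\mathrm{content}(T[i]),i)$; set-driven $\mathbf{Sd}(h,T)(i)=h(\mathrm{content}(T[i]))$. Restrictions on hypothesis sequence $p$ and text $T$: $\mathbf{Ex}_C$: there is $n_0$ with $p(n)=p(n_0)$ for all $n\ge n_0$ and $p(n_0)$ a $C$-index with $C_{p(n_0)}=\mathrm{content}(T)$; $\mathbf{Bc}_W$: there is $n_0$ such that $W_{p(n)}=\mathrm{content}(T)$ for all $n\ge n_0$; $\mathbf{CInd}$: for all $i$, $p(i)$ is a $C$-index. A learner $h$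 $\tau(\alpha)\mathbf{Txt}\beta\delta$-learns $L$ iff $\alpha(\beta(h,T),T)$ holds for every text $T$ whatsoever and $\delta(\beta(h,T),T)$ holds for every text $T$ for $L$ (omitting $\tau(\alpha)$ means no global requirement). $[\tau(\alpha)\mathbf{Txt}\beta\delta]_{\mathbf{REC}}$ is the set of all classes $\mathcal{L}\subseteq\mathbf{REC}$ for which some $h\in\mathcal{P}$ learns every $L\in\mathcal{L}$ in this sense. -}

module Defs where

open import Data.Nat using (ℕ; zero; suc; _+_; _^_; _≤_; _<_; ⌊_/2⌋)
open import Data.Bool using (Bool; true; false; not; if_then_else_)
open import Data.Maybe using (Maybe; just; nothing)
open import Data.List using (List; []; _∷_)
open import Data.Product using (Σ; _×_; _,_)
open import Relation.Binary.PropositionalEquality using (_≡_)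
open import Relation.Nullary using (¬_)
open import Function.Bundles using (_⇔_)

-- Cantor pairing  ⟪ x , y ⟫ = (x+y)(x+y+1)/2 + x   (a bijection ℕ×ℕ → ℕ)

tri : ℕ → ℕ
tri zero    = zero
tri (suc n) = tri n + suc n

⟪_,_⟫ : ℕ → ℕ → ℕ
⟪ x , y ⟫ = tri (x + y) + x

-- Partial computable functions: unary μ-recursive functions over ℕ
-- (n-ary arguments coded via the pairing function).

data Code : Set where
  zer  : Code
  sc   : Code
  fst  : Code
  snd  : Code
  comp : Code → Code → Code
  pair : Code → Code → Code
  rec  : Code → Code → Code   -- primitive recursion on 2nd component
  mu   : Code → Code

infix 4 _∶_↦_
data _∶_↦_ : Code → ℕ → ℕ → Set where
  zerE  : ∀ {x} → zer ∶ x ↦ 0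
  scE   : ∀ {x} → sc ∶ x ↦ suc x
  fstE  : ∀ {x y} → fst ∶ ⟪ x , y ⟫ ↦ x
  sndE  : ∀ {x y} → snd ∶ ⟪ x , y ⟫ ↦ y
  compE : ∀ {f g x y z} → g ∶ x ↦ y → f ∶ y ↦ z → comp f g ∶ x ↦ z
  pairE : ∀ {f g x y z} → f ∶ x ↦ y → g ∶ x ↦ z → pair f g ∶ x ↦ ⟪ y , z ⟫
  recZ  : ∀ {f g x y} → f ∶ x ↦ y → rec f g ∶ ⟪ x , 0 ⟫ ↦ y
  recS  : ∀ {f g x n y z} → rec f g ∶ ⟪ x , n ⟫ ↦ y →
          g ∶ ⟪ ⟪ x , n ⟫ , y ⟫ ↦ z → rec f g ∶ ⟪ x , suc n ⟫ ↦ z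
  muE   : ∀ {f x n} → f ∶ ⟪ x , n ⟫ ↦ 0 →
          (∀ m → m < n → Σ ℕ (λ k → f ∶ ⟪ x , m ⟫ ↦ suc k)) →
          mu f ∶ x ↦ n

-- Numberings of partial functions, given by their graphs:
-- ψ e x y  means  ψ_e(x) = y.

Numbering : Set₁
Numbering = ℕ → ℕ → ℕ → Set

-- Acceptable numbering (Rogers): the universal function is partial
-- computable, and for every partial computable binary f there is a total
-- computable s with ψ_{s(i)}(x) = f(i,x).  (This makes ψ a numbering of
-- exactly the partial computable functions.)
record Acceptable (ψ : Numbering) : Set where
  field
    universal : Σ Code λ u → ∀ e x y → ψ e x y ⇔ (u ∶ ⟪ e , x ⟫ ↦ y)
    smn       : ∀ (c : Code) → Σ Code λ s → ∀ i → Σ ℕ λ j →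
                  (s ∶ i ↦ j) × (∀ x y → ψ j x y ⇔ (c ∶ ⟪ i , x ⟫ ↦ y))

module _ (ψ : Numbering) where

  CIndex : ℕ → Set
  CIndex e = ∀ x → Σ ℕ λ b → ψ e x b × b ≤ 1

  C : ℕ → ℕ → Set
  C e x = ψ e x 1

  W : ℕ → ℕ → Set
  W e x = Σ ℕ λ y → ψ e x y

SetN : Set₁
SetN = ℕ → Set

_≐_ : SetN → SetN → Set
A ≐ B = ∀ x → A x ⇔ B x

REC : Numbering → SetN → Set
REC ψ L = Σ ℕ λ e → CIndex ψ e × (C ψ e ≐ L)

-- Texts (nothing = pause symbol #)

Text : Set
Text = ℕ → Maybe ℕ

content : Text → SetN
content T x = Σ ℕ λ n → T n ≡ just x

TextFor : Text → SetN → Set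
TextFor T L = content T ≐ L

-- T[n] as a list (T(n-1), ..., T(0)); order is irrelevant below
prefix : Text → ℕ → List (Maybe ℕ)
prefix T zero    = []
prefix T (suc n) = T n ∷ prefix T n

-- canonical coding of finite sets: D ↦ Σ_{x ∈ D} 2^x
odd : ℕ → Bool
odd zero    = false
odd (suc n) = not (odd n)

bit : ℕ → ℕ → Bool
bit n zero    = odd n
bit n (suc x) = bit ⌊ n /2⌋ x

addElem : ℕ → ℕ → ℕ
addElem x n = if bit n x then n else n + 2 ^ x

setCode : List (Maybe ℕ) → ℕ
setCode []             = 0
setCode (nothing ∷ l)  = setCode l
setCode (just x ∷ l)   = addElem x (setCode l)

contentCode : Text → ℕ → ℕ
contentCode T i = setCode (prefix T i)

-- Hypothesis sequences (as graphs of partial sequences): p i e  means p(i) = e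

HSeq : Set₁
HSeq = ℕ → ℕ → Set

Psd : Code → Text → HSeq
Psd h T i e = h ∶ ⟪ contentCode T i , i ⟫ ↦ e

Sd : Code → Text → HSeq
Sd h T i e = h ∶ contentCode T i ↦ e

module _ (ψ : Numbering) where

  CInd : HSeq → Text → Set
  CInd p T = ∀ i → Σ ℕ λ e → p i e × CIndex ψ e

  ExC : HSeq → Text → Set
  ExC p T = Σ ℕ λ n₀ → Σ ℕ λ e →
              (∀ n → n₀ ≤ n → p n e) × CIndex ψ e × (C ψ e ≐ content T)

  BcW : HSeq → Text → Set
  BcW p T = Σ ℕ λ n₀ → ∀ n → n₀ ≤ n → Σ ℕ λ e → p n e × (W ψ e ≐ content T)

Class : Set₂
Class = SetN → Set₁

module _ (ψ : Numbering) where

  InτCIndTxtPsdExC : Class → Set₁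
  InτCIndTxtPsdExC 𝓛 = Σ Code λ h →
    (∀ T → CInd ψ (Psd h T) T) ×
    (∀ L → 𝓛 L → ∀ T → TextFor T L → ExC ψ (Psd h T) T)

  InTxtSdBcW : Class → Set₁
  InTxtSdBcW 𝓛 = Σ Code λ h →
    ∀ L → 𝓛 L → ∀ T → TextFor T L → BcW ψ (Sd h T) T

-- A program k overshoots when, run on the code of an initial segment {⟪ k , 0 ⟫, …, ⟪ k , n ⟫} of
-- the k-th stream, it conjectures an index whose domain contains some ⟪ k , m ⟫ with m > n; this is
-- semi-decidable, and an overshoot stage s records n, m and a step bound. The class contains, for
-- each k, the whole k-th stream if k never overshoots, and otherwise the segment up to n of the least
-- overshoot stage. A partially set-driven learner reads k off its data and, knowing the number i of
-- data seen, checks the stages below i for an overshoot, so it is total, always outputs a C-index,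
-- and converges to the right one. A set-driven learner h fails on the language chosen for an index k
-- of h itself: if k never overshoots, h must eventually conjecture the whole stream on one of its
-- initial segments, which is an overshoot; if k overshoots at stage s, then on the text of the
-- segment up to n followed by pauses h keeps the conjecture it made on that segment, whose domain
-- contains ⟪ k , m ⟫ with m > n.

module Submission where

open import Defs
open import Data.Bool using (Bool; true; false; if_then_else_)
open import Data.Bool.Properties using (not-involutive)
open import Data.Empty using (⊥; ⊥-elim)
open import Data.List using ([]; _∷_)
open import Data.List.Membership.Propositional using (_∈_)
open import Data.List.Relation.Unary.Any using (here; there)
open import Data.Maybe using (Maybe; just; nothing)
open import Data.Maybe.Properties using (just-injective)
open import Data.Nat
open import Data.Nat.Properties
open import Data.Product using (Σ; _×_; _,_; proj₁; proj₂)
open import Data.Sum using (_⊎_; inj₁; inj₂)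
open import Function using (_∘_)
open import Function.Bundles using (_⇔_; mk⇔; Equivalence)
open import Function.Properties.Equivalence using ()
  renaming (refl to ⇔-refl; sym to ⇔-sym; trans to ⇔-trans)
open import Level using (Lift; lift; 0ℓ) renaming (suc to lsuc)
open import Relation.Binary.PropositionalEquality
open import Relation.Nullary using (¬_; yes; no)

nextPair : ℕ × ℕ → ℕ × ℕ
nextPair (a , zero)  = 0 , suc a
nextPair (a , suc b) = suc a , b

unpair : ℕ → ℕ × ℕ
unpair zero    = 0 , 0
unpair (suc n) = nextPair (unpair n)

π₁ π₂ : ℕ → ℕ
π₁ n = proj₁ (unpair n)
π₂ n = proj₂ (unpair n)

⟪1+a,b⟫≡1+⟪a,1+b⟫ : ∀ a b → ⟪ suc a , b ⟫ ≡ suc ⟪ a , suc b ⟫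
⟪1+a,b⟫≡1+⟪a,1+b⟫ a b rewrite +-suc a b = +-suc (tri (suc (a + b))) a

⟪0,1+b⟫≡1+⟪b,0⟫ : ∀ b → ⟪ 0 , suc b ⟫ ≡ suc ⟪ b , 0 ⟫
⟪0,1+b⟫≡1+⟪b,0⟫ b rewrite +-identityʳ b | +-identityʳ (tri b + suc b) = +-suc (tri b) b

⟪⟫-nextPair : ∀ p → ⟪ proj₁ (nextPair p) , proj₂ (nextPair p) ⟫ ≡ suc ⟪ proj₁ p , proj₂ p ⟫
⟪⟫-nextPair (a , zero)  = ⟪0,1+b⟫≡1+⟪b,0⟫ a
⟪⟫-nextPair (a , suc b) = ⟪1+a,b⟫≡1+⟪a,1+b⟫ a b

⟪π₁,π₂⟫ : ∀ n → ⟪ π₁ n , π₂ n ⟫ ≡ n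
⟪π₁,π₂⟫ zero    = refl
⟪π₁,π₂⟫ (suc n) = trans (⟪⟫-nextPair (unpair n)) (cong suc (⟪π₁,π₂⟫ n))

unpair-⟪⟫ : ∀ a b → unpair ⟪ a , b ⟫ ≡ (a , b)
unpair-⟪⟫ a b = go _ a b refl
  where
  go : ∀ n a b → ⟪ a , b ⟫ ≡ n → unpair n ≡ (a , b)
  go zero    zero    zero    _ = refl
  go zero    zero    (suc b) e with () ← trans (sym (⟪0,1+b⟫≡1+⟪b,0⟫ b)) e
  go zero    (suc a) b       e with () ← trans (sym (⟪1+a,b⟫≡1+⟪a,1+b⟫ a b)) e
  go (suc n) zero    zero    ()
  go (suc n) zero    (suc b) e
    rewrite go n b 0 (suc-injective (trans (sym (⟪0,1+b⟫≡1+⟪b,0⟫ b)) e)) = refl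
  go (suc n) (suc a) b       e
    rewrite go n a (suc b) (suc-injective (trans (sym (⟪1+a,b⟫≡1+⟪a,1+b⟫ a b)) e)) = refl

π₁-⟪⟫ : ∀ a b → π₁ ⟪ a , b ⟫ ≡ a
π₁-⟪⟫ a b = cong proj₁ (unpair-⟪⟫ a b)

π₂-⟪⟫ : ∀ a b → π₂ ⟪ a , b ⟫ ≡ b
π₂-⟪⟫ a b = cong proj₂ (unpair-⟪⟫ a b)

⟪⟫-injectiveʳ : ∀ {a b c d} → ⟪ a , b ⟫ ≡ ⟪ c , d ⟫ → b ≡ d
⟪⟫-injectiveʳ {a} {b} {c} {d} e = trans (sym (π₂-⟪⟫ a b)) (trans (cong π₂ e) (π₂-⟪⟫ c d))

fst-↦ : ∀ x → fst ∶ x ↦ π₁ x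
fst-↦ x = subst (λ z → fst ∶ z ↦ π₁ x) (⟪π₁,π₂⟫ x) fstE

snd-↦ : ∀ x → snd ∶ x ↦ π₂ x
snd-↦ x = subst (λ z → snd ∶ z ↦ π₂ x) (⟪π₁,π₂⟫ x) (sndE {π₁ x})

ifz : ℕ → ℕ → ℕ → ℕ
ifz zero    a b = a
ifz (suc _) a b = b

isZero : ℕ → ℕ
isZero n = ifz n 1 0

primRec : ℕ → (ℕ → ℕ → ℕ) → ℕ → ℕ
primRec b G zero    = b
primRec b G (suc n) = G n (primRec b G n)

-- search p N is 1 + the least j < N with p j ≢ 0, or 0 if there is none.
search : (ℕ → ℕ) → ℕ → ℕ
search p = primRec 0 (λ j y → ifz y (ifz (p j) 0 (suc j)) y)

search≡0⇒zeros : ∀ p N → search p N ≡ 0 → ∀ i → i < N → p i ≡ 0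
search≡0⇒zeros p (suc N) e i i<1+N with search p N in eq | e
... | zero | e′ with p N in eqp | e′
... | zero | _ with m≤n⇒m<n∨m≡n (≤-pred i<1+N)
...   | inj₁ i<N  = search≡0⇒zeros p N eq i i<N
...   | inj₂ refl = eqp

zeros⇒search≡0 : ∀ p N → (∀ i → i < N → p i ≡ 0) → search p N ≡ 0
zeros⇒search≡0 p zero    _ = refl
zeros⇒search≡0 p (suc N) h
  rewrite zeros⇒search≡0 p N (λ i i<N → h i (m<n⇒m<1+n i<N)) | h N ≤-refl = refl

search≡1+j⇒least : ∀ p N j → search p N ≡ suc j →
                   j < N × p j ≢ 0 × (∀ i → i < j → p i ≡ 0)
search≡1+j⇒least p (suc N) j e with search p N in eq | e
... | suc _ | refl with search≡1+j⇒least p N j eq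
...   | j<N , pj , below = m<n⇒m<1+n j<N , pj , below
search≡1+j⇒least p (suc N) j e | zero | e′ with p N in eqp | e′
... | suc _ | refl = ≤-refl , (λ pN≡0 → 1+n≢0 (trans (sym eqp) pN≡0)) , search≡0⇒zeros p N eq

least⇒search≡1+j : ∀ p N j → j < N → p j ≢ 0 → (∀ i → i < j → p i ≡ 0) → search p N ≡ suc j
least⇒search≡1+j p (suc N) j (s≤s j≤N) pj below with m≤n⇒m<n∨m≡n j≤N
... | inj₁ j<N rewrite least⇒search≡1+j p N j j<N pj below = refl
... | inj₂ refl rewrite zeros⇒search≡0 p N below with p j in eqp
...   | zero  = ⊥-elim (pj refl)
...   | suc _ = refl

search-nonzero : ∀ p N j → p j ≢ 0 → j < N → Σ ℕ λ j′ → search p N ≡ suc j′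
search-nonzero p N j pj j<N with search p N in eq
... | suc j′ = j′ , refl
... | zero   = ⊥-elim (pj (search≡0⇒zeros p N eq j j<N))

search-cong : ∀ p q N → (∀ j → p j ≡ q j) → search p N ≡ search q N
search-cong p q zero    _ = refl
search-cong p q (suc N) h rewrite search-cong p q N h | h N = refl

least-nonzero : ∀ p j → p j ≢ 0 → Σ ℕ λ j′ → p j′ ≢ 0 × (∀ i → i < j′ → p i ≡ 0)
least-nonzero p j pj with search-nonzero p (suc j) j pj ≤-refl
... | j′ , found with search≡1+j⇒least p (suc j) j′ found
...   | _ , pj′ , below = j′ , pj′ , below

isZero-pred≡0 : ∀ v → isZero (pred v) ≡ 0 → Σ ℕ λ k → v ≡ suc (suc k)
isZero-pred≡0 (suc (suc k)) _ = k , refl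

isZero≢0 : ∀ n → isZero n ≢ 0 → n ≡ 0
isZero≢0 zero    _    = refl
isZero≢0 (suc n) ≢0 = ⊥-elim (≢0 refl)

-- The μ-search inspects j ≤ t and stops at the first j where v j is undefined (0) or the value 0 (1).
muStop : (ℕ → ℕ) → ℕ → ℕ
muStop v t = search (λ j → isZero (pred (v j))) (suc t)

evalMu : (ℕ → ℕ) → ℕ → ℕ
evalMu v t = ifz (muStop v t) 0 (ifz (v (pred (muStop v t))) 0 (muStop v t))

-- eval c x t is 1 + the value of c at x, or 0 when the fuel t does not suffice.
eval    : Code → ℕ → ℕ → ℕ
evalRec : Code → Code → ℕ → ℕ → ℕ → ℕ

eval zer        x t = 1
eval sc         x t = suc (suc x)
eval fst        x t = suc (π₁ x)
eval snd        x t = suc (π₂ x)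
eval (comp f g) x t = ifz (eval g x t) 0 (eval f (pred (eval g x t)) t)
eval (pair f g) x t = ifz (eval f x t) 0 (ifz (eval g x t) 0 (suc ⟪ pred (eval f x t) , pred (eval g x t) ⟫))
eval (rec f g)  x t = evalRec f g (π₁ x) (π₂ x) t
eval (mu f)     x t = evalMu (λ j → eval f ⟪ x , j ⟫ t) t

evalRec f g a n t = primRec (eval f a t) (λ m y → ifz y 0 (eval g ⟪ ⟪ a , m ⟫ , pred y ⟫ t)) n

eval-rec-⟪⟫ : ∀ f g a n t → eval (rec f g) ⟪ a , n ⟫ t ≡ evalRec f g a n t
eval-rec-⟪⟫ f g a n t = cong (λ p → evalRec f g (proj₁ p) (proj₂ p) t) (unpair-⟪⟫ a n)

evalMu≡1+n : ∀ v t n → n ≤ t → v n ≡ 1 → (∀ m → m < n → Σ ℕ λ k → v m ≡ suc (suc k)) →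
             evalMu v t ≡ suc n
evalMu≡1+n v t n n≤t vn≡1 below
  rewrite least⇒search≡1+j (λ j → isZero (pred (v j))) (suc t) n (s≤s n≤t)
            (λ stops → 1+n≢0 (trans (sym (cong (isZero ∘ pred) vn≡1)) stops))
            (λ m m<n → cong (isZero ∘ pred) (proj₂ (below m m<n)))
        | vn≡1 = refl

eval-sound : ∀ c x t y → eval c x t ≡ suc y → c ∶ x ↦ y
eval-sound zer x t y refl = zerE
eval-sound sc  x t y refl = scE
eval-sound fst x t y refl = fst-↦ x
eval-sound snd x t y refl = snd-↦ x
eval-sound (comp f g) x t y e with eval g x t in eg | e
... | suc a | e′ = compE (eval-sound g x t a eg) (eval-sound f a t y e′)
eval-sound (pair f g) x t y e with eval f x t in ef | e
... | suc a | e′ with eval g x t in eg | e′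
...   | suc b | refl = pairE (eval-sound f x t a ef) (eval-sound g x t b eg)
eval-sound (rec f g) x t y e = subst (λ z → rec f g ∶ z ↦ y) (⟪π₁,π₂⟫ x) (go (π₂ x) y e)
  where
  go : ∀ n y → evalRec f g (π₁ x) n t ≡ suc y → rec f g ∶ ⟪ π₁ x , n ⟫ ↦ y
  go zero    y e = recZ (eval-sound f (π₁ x) t y e)
  go (suc n) y e with evalRec f g (π₁ x) n t in er | e
  ... | suc w | e′ = recS {x = π₁ x} {n = n} (go n w er) (eval-sound g _ t y e′)
eval-sound (mu f) x t y e with muStop (λ j → eval f ⟪ x , j ⟫ t) t in er | e
... | suc j | e′ with eval f ⟪ x , j ⟫ t in ev | e′
...   | suc k | refl with search≡1+j⇒least _ (suc t) j er
...     | _ , stops , below = muE (eval-sound f _ t 0 (trans ev (cong suc k≡0))) defined-below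
  where
  k≡0 : k ≡ 0
  k≡0 = isZero≢0 k (subst (λ v → isZero (pred v) ≢ 0) ev stops)
  defined-below : ∀ m → m < j → Σ ℕ λ k → f ∶ ⟪ x , m ⟫ ↦ suc k
  defined-below m m<j with isZero-pred≡0 _ (below m m<j)
  ... | k , evm = k , eval-sound f _ t (suc k) evm

Eventually : (ℕ → Set) → Set
Eventually P = Σ ℕ λ t₀ → ∀ t → t₀ ≤ t → P t

eventually-map : ∀ {P Q : ℕ → Set} → (∀ {t} → P t → Q t) → Eventually P → Eventually Q
eventually-map f (t₀ , p) = t₀ , λ t t₀≤t → f (p t t₀≤t)

eventually-× : ∀ {P Q : ℕ → Set} → Eventually P → Eventually Q → Eventually (λ t → P t × Q t)
eventually-× (t₁ , p) (t₂ , q) =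
  t₁ ⊔ t₂ , λ t le → p t (≤-trans (m≤m⊔n t₁ t₂) le) , q t (≤-trans (m≤n⊔m t₁ t₂) le)

eventually-below : ∀ (Q : ℕ → ℕ → Set) n → (∀ m → m < n → Eventually (Q m)) →
                   Eventually (λ t → ∀ m → m < n → Q m t)
eventually-below Q zero    _ = 0 , λ _ _ _ ()
eventually-below Q (suc n) h =
  eventually-map extend (eventually-× (eventually-below Q n (λ m m<n → h m (m<n⇒m<1+n m<n))) (h n ≤-refl))
  where
  extend : ∀ {t} → (∀ m → m < n → Q m t) × Q n t → ∀ m → m < suc n → Q m t
  extend (below , at) m (s≤s m≤n) with m≤n⇒m<n∨m≡n m≤n
  ... | inj₁ m<n  = below m m<n
  ... | inj₂ refl = at

eventually-≥ : ∀ n → Eventually (n ≤_)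
eventually-≥ n = n , λ _ n≤t → n≤t

eval-complete : ∀ {c x y} → c ∶ x ↦ y → Eventually (λ t → eval c x t ≡ suc y)
eval-complete zerE = 0 , λ _ _ → refl
eval-complete scE  = 0 , λ _ _ → refl
eval-complete (fstE {x} {y}) = 0 , λ _ _ → cong suc (π₁-⟪⟫ x y)
eval-complete (sndE {x} {y}) = 0 , λ _ _ → cong suc (π₂-⟪⟫ x y)
eval-complete (compE {f} d₁ d₂) =
  eventually-map (λ {t} (e₁ , e₂) → trans (cong (λ v → ifz v 0 (eval f (pred v) t)) e₁) e₂)
    (eventually-× (eval-complete d₁) (eval-complete d₂))
eval-complete (pairE d₁ d₂) =
  eventually-map (λ (e₁ , e₂) → cong₂ (λ v w → ifz v 0 (ifz w 0 (suc ⟪ pred v , pred w ⟫))) e₁ e₂)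
    (eventually-× (eval-complete d₁) (eval-complete d₂))
eval-complete (recZ {f} {g} {x} d) =
  eventually-map (λ {t} e → trans (eval-rec-⟪⟫ f g x 0 t) e) (eval-complete d)
eval-complete (recS {f} {g} {x} {n} d₁ d₂) =
  eventually-map (λ {t} (e₁ , e₂) →
      trans (eval-rec-⟪⟫ f g x (suc n) t)
        (trans (cong (λ v → ifz v 0 (eval g ⟪ ⟪ x , n ⟫ , pred v ⟫ t))
                     (trans (sym (eval-rec-⟪⟫ f g x n t)) e₁))
               e₂))
    (eventually-× (eval-complete d₁) (eval-complete d₂))
eval-complete (muE {f} {x} {n} d below) =
  eventually-map (λ {t} (n≤t , e , below-t) → evalMu≡1+n _ t n n≤t e below-t)
    (eventually-× (eventually-≥ n) (eventually-× (eval-complete d) (eventually-below _ n defined)))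
  where
  defined : ∀ m → m < n → Eventually (λ t → Σ ℕ λ k → eval f ⟪ x , m ⟫ t ≡ suc (suc k))
  defined m m<n = eventually-map (λ e → proj₁ (below m m<n) , e) (eval-complete (proj₂ (below m m<n)))

↦-functional : ∀ {c x y y′} → c ∶ x ↦ y → c ∶ x ↦ y′ → y ≡ y′
↦-functional d₁ d₂ with eventually-× (eval-complete d₁) (eval-complete d₂)
... | t₀ , both = suc-injective (trans (sym (proj₁ (both t₀ ≤-refl))) (proj₂ (both t₀ ≤-refl)))

↦⇔≡ : ∀ {c x v} → c ∶ x ↦ v → ∀ y → c ∶ x ↦ y ⇔ v ≡ y
↦⇔≡ {c} {x} d y = mk⇔ (↦-functional d) (λ v≡y → subst (c ∶ x ↦_) v≡y d)

comp-snd-↦ : ∀ h a x y → comp h snd ∶ ⟪ a , x ⟫ ↦ y ⇔ h ∶ x ↦ y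
comp-snd-↦ h a x y = mk⇔ to (compE (sndE {a}))
  where
  to : comp h snd ∶ ⟪ a , x ⟫ ↦ y → h ∶ x ↦ y
  to (compE d₁ d₂) = subst (λ z → h ∶ z ↦ y) (↦-functional d₁ (sndE {a})) d₂

-- Primitive recursive terms over trees of numbers

-- Terms act on trees so that projections of a node reduce definitionally; compile-correct
-- transfers their semantics to codes through enc.
data Tree : Set where
  leaf : ℕ → Tree
  node : Tree → Tree → Tree

enc : Tree → ℕ
enc (leaf n)   = n
enc (node a b) = ⟪ enc a , enc b ⟫

-- A leaf is split by decoding its number, so splitting commutes with enc.
left right : Tree → Tree
left  (leaf n)   = leaf (π₁ n)
left  (node a _) = a
right (leaf n)   = leaf (π₂ n)
right (node _ b) = b

⟪left,right⟫ : ∀ v → ⟪ enc (left v) , enc (right v) ⟫ ≡ enc v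
⟪left,right⟫ (leaf n)   = ⟪π₁,π₂⟫ n
⟪left,right⟫ (node a b) = refl

enc-left : ∀ v → enc (left v) ≡ π₁ (enc v)
enc-left (leaf n)   = refl
enc-left (node a b) = sym (π₁-⟪⟫ (enc a) (enc b))

enc-right : ∀ v → enc (right v) ≡ π₂ (enc v)
enc-right (leaf n)   = refl
enc-right (node a b) = sym (π₂-⟪⟫ (enc a) (enc b))

infixr 9 _∘ₑ_
data Expr : Set where
  Z S I P₁ P₂ : Expr
  _∘ₑ_   : Expr → Expr → Expr
  ⟨_,_⟩ₑ : Expr → Expr → Expr
  R      : Expr → Expr → Expr

treeRec : Tree → (ℕ → Tree → Tree) → ℕ → Tree
treeRec b G zero    = b
treeRec b G (suc n) = G n (treeRec b G n)

⟦_⟧ : Expr → Tree → Tree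
⟦ Z ⟧         v = leaf 0
⟦ S ⟧         v = leaf (suc (enc v))
⟦ I ⟧         v = v
⟦ P₁ ⟧        v = left v
⟦ P₂ ⟧        v = right v
⟦ f ∘ₑ g ⟧    v = ⟦ f ⟧ (⟦ g ⟧ v)
⟦ ⟨ f , g ⟩ₑ ⟧ v = node (⟦ f ⟧ v) (⟦ g ⟧ v)
⟦ R f g ⟧     v = treeRec (⟦ f ⟧ (left v)) (λ m y → ⟦ g ⟧ (node (node (left v) (leaf m)) y)) (enc (right v))

⟦_⟧ₙ : Expr → Tree → ℕ
⟦ e ⟧ₙ v = enc (⟦ e ⟧ v)

enc-treeRec : ∀ b G G′ → (∀ m y → enc (G m y) ≡ G′ m (enc y)) →
              ∀ n → enc (treeRec b G n) ≡ primRec (enc b) G′ n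
enc-treeRec b G G′ h zero    = refl
enc-treeRec b G G′ h (suc n) = trans (h n _) (cong (G′ n) (enc-treeRec b G G′ h n))

predCode : Code
predCode = rec zer (comp snd fst)

predCode-↦ : ∀ x n → predCode ∶ ⟪ x , n ⟫ ↦ pred n
predCode-↦ x zero    = recZ {x = x} zerE
predCode-↦ x (suc n) = recS {x = x} {n = n} (predCode-↦ x n) (compE (fstE {⟪ x , n ⟫}) (sndE {x}))

idCode : Code
idCode = comp predCode (pair zer sc)

idCode-↦ : ∀ x → idCode ∶ x ↦ x
idCode-↦ x = compE (pairE zerE scE) (predCode-↦ 0 (suc x))

compile : Expr → Code
compile Z          = zer
compile S          = sc
compile I          = idCode
compile P₁         = fst
compile P₂         = snd
compile (f ∘ₑ g)    = comp (compile f) (compile g)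
compile ⟨ f , g ⟩ₑ  = pair (compile f) (compile g)
compile (R f g)    = rec (compile f) (compile g)

compile-correct : ∀ e v → compile e ∶ enc v ↦ ⟦ e ⟧ₙ v
compile-correct Z        v = zerE
compile-correct S        v = scE
compile-correct I        v = idCode-↦ (enc v)
compile-correct P₁       v = subst (λ z → fst ∶ z ↦ enc (left v)) (⟪left,right⟫ v) fstE
compile-correct P₂       v = subst (λ z → snd ∶ z ↦ enc (right v)) (⟪left,right⟫ v) (sndE {enc (left v)})
compile-correct (f ∘ₑ g)  v = compE (compile-correct g v) (compile-correct f (⟦ g ⟧ v))
compile-correct ⟨ f , g ⟩ₑ v = pairE (compile-correct f v) (compile-correct g v)
compile-correct (R f g)  v =
  subst (λ z → rec (compile f) (compile g) ∶ z ↦ ⟦ R f g ⟧ₙ v) (⟪left,right⟫ v) (go (enc (right v)))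
  where
  go : ∀ n → rec (compile f) (compile g) ∶ ⟪ enc (left v) , n ⟫ ↦
             enc (treeRec (⟦ f ⟧ (left v)) (λ m y → ⟦ g ⟧ (node (node (left v) (leaf m)) y)) n)
  go zero    = recZ {x = enc (left v)} (compile-correct f (left v))
  go (suc n) = recS {x = enc (left v)} {n = n} (go n) (compile-correct g _)

K : ℕ → Expr
K zero    = Z
K (suc n) = S ∘ₑ K n

ifzE : Expr → Expr → Expr → Expr
ifzE a b c = R P₁ (P₂ ∘ₑ P₁ ∘ₑ P₁) ∘ₑ ⟨ ⟨ a , b ⟩ₑ , c ⟩ₑ

ifzE-correct : ∀ a b c v → ⟦ ifzE a b c ⟧ₙ v ≡ ifz (⟦ c ⟧ₙ v) (⟦ a ⟧ₙ v) (⟦ b ⟧ₙ v)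
ifzE-correct a b c v with ⟦ c ⟧ₙ v
... | zero  = refl
... | suc _ = refl

predE : Expr
predE = R Z (P₂ ∘ₑ P₁) ∘ₑ ⟨ Z , I ⟩ₑ

predE-correct : ∀ v → ⟦ predE ⟧ₙ v ≡ pred (enc v)
predE-correct v with enc v
... | zero  = refl
... | suc _ = refl

addE : Expr
addE = R I (S ∘ₑ P₂)

addE-correct : ∀ a b → ⟦ addE ⟧ₙ (node a b) ≡ enc a + enc b
addE-correct a b = trans (enc-treeRec a _ (λ _ y → suc y) (λ _ _ → refl) (enc b)) (go (enc a) (enc b))
  where
  go : ∀ x n → primRec x (λ _ y → suc y) n ≡ x + n
  go x zero    = sym (+-identityʳ x)
  go x (suc n) = trans (cong suc (go x n)) (sym (+-suc x n))

monusE : Expr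
monusE = R I (predE ∘ₑ P₂)

monusE-correct : ∀ a b → ⟦ monusE ⟧ₙ (node a b) ≡ enc a ∸ enc b
monusE-correct a b =
  trans (enc-treeRec a _ (λ _ y → pred y) (λ _ y → predE-correct y) (enc b)) (go (enc a) (enc b))
  where
  go : ∀ x n → primRec x (λ _ y → pred y) n ≡ x ∸ n
  go x zero    = refl
  go x (suc n) = trans (cong pred (go x n)) (pred[m∸n]≡m∸[1+n] x n)

isZeroE : Expr → Expr
isZeroE = ifzE (K 1) (K 0)

isZeroE-correct : ∀ x v → ⟦ isZeroE x ⟧ₙ v ≡ isZero (⟦ x ⟧ₙ v)
isZeroE-correct x = ifzE-correct (K 1) (K 0) x

searchStepE : Expr → Expr
searchStepE P = ifzE (ifzE Z (S ∘ₑ P₂ ∘ₑ P₁) (P ∘ₑ ⟨ P₁ ∘ₑ P₁ , P₂ ∘ₑ P₁ ⟩ₑ)) P₂ P₂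

searchE : Expr → Expr
searchE P = R Z (searchStepE P)

searchE-correct : ∀ P z N → ⟦ searchE P ⟧ₙ (node z N) ≡ search (λ j → ⟦ P ⟧ₙ (node z (leaf j))) (enc N)
searchE-correct P z N = enc-treeRec (leaf 0) _ _ step (enc N)
  where
  step : ∀ j y → ⟦ searchStepE P ⟧ₙ (node (node z (leaf j)) y) ≡
                 ifz (enc y) (ifz (⟦ P ⟧ₙ (node z (leaf j))) 0 (suc j)) (enc y)
  step j y = trans (ifzE-correct (ifzE Z (S ∘ₑ P₂ ∘ₑ P₁) test) P₂ P₂ (node (node z (leaf j)) y))
    (cong (λ q → ifz (enc y) q (enc y)) (ifzE-correct Z (S ∘ₑ P₂ ∘ₑ P₁) test (node (node z (leaf j)) y)))
    where
    test : Expr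
    test = P ∘ₑ ⟨ P₁ ∘ₑ P₁ , P₂ ∘ₑ P₁ ⟩ₑ

-- The fuel evaluator is primitive recursive

evalE     : Code → Expr
recStepE  : Code → Expr
muSearchE : Code → Expr

evalE zer        = K 1
evalE sc         = S ∘ₑ S ∘ₑ P₁
evalE fst        = S ∘ₑ P₁ ∘ₑ P₁
evalE snd        = S ∘ₑ P₂ ∘ₑ P₁
evalE (comp f g) = ifzE Z (evalE f ∘ₑ ⟨ predE ∘ₑ evalE g , P₂ ⟩ₑ) (evalE g)
evalE (pair f g) = ifzE Z (ifzE Z (S ∘ₑ ⟨ predE ∘ₑ evalE f , predE ∘ₑ evalE g ⟩ₑ) (evalE g)) (evalE f)
evalE (rec f g)  = R (evalE f) (recStepE g) ∘ₑ ⟨ ⟨ P₁ ∘ₑ P₁ , P₂ ⟩ₑ , P₂ ∘ₑ P₁ ⟩ₑ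
evalE (mu f)     = ifzE Z (ifzE Z (muSearchE f) (evalE f ∘ₑ ⟨ ⟨ P₁ , predE ∘ₑ muSearchE f ⟩ₑ , P₂ ⟩ₑ))
                          (muSearchE f)

recStepE g =
  ifzE Z (evalE g ∘ₑ ⟨ ⟨ ⟨ P₁ ∘ₑ P₁ ∘ₑ P₁ , P₂ ∘ₑ P₁ ⟩ₑ , predE ∘ₑ P₂ ⟩ₑ , P₂ ∘ₑ P₁ ∘ₑ P₁ ⟩ₑ) P₂

muSearchE f =
  searchE (isZeroE (predE ∘ₑ evalE f ∘ₑ ⟨ ⟨ P₁ ∘ₑ P₁ , P₂ ⟩ₑ , P₂ ∘ₑ P₁ ⟩ₑ)) ∘ₑ ⟨ I , S ∘ₑ P₂ ⟩ₑ

evalE-correct : ∀ c v w → ⟦ evalE c ⟧ₙ (node v w) ≡ eval c (enc v) (enc w)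

pred-evalE : ∀ c v w → ⟦ predE ∘ₑ evalE c ⟧ₙ (node v w) ≡ pred (eval c (enc v) (enc w))
pred-evalE c v w = trans (predE-correct (⟦ evalE c ⟧ (node v w))) (cong pred (evalE-correct c v w))

muSearchE-correct : ∀ f v w →
  ⟦ muSearchE f ⟧ₙ (node v w) ≡ muStop (λ j → eval f ⟪ enc v , j ⟫ (enc w)) (enc w)
muSearchE-correct f v w =
  trans (searchE-correct test (node v w) (leaf (suc (enc w))))
        (search-cong _ _ (suc (enc w)) (λ j →
           trans (isZeroE-correct (predE ∘ₑ evalE f ∘ₑ args) (node (node v w) (leaf j)))
                 (cong isZero (pred-evalE f (node v (leaf j)) w))))
  where
  args test : Expr
  args = ⟨ ⟨ P₁ ∘ₑ P₁ , P₂ ⟩ₑ , P₂ ∘ₑ P₁ ⟩ₑ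
  test = isZeroE (predE ∘ₑ evalE f ∘ₑ args)

evalE-correct zer v w = refl
evalE-correct sc  v w = refl
evalE-correct fst v w = cong suc (enc-left v)
evalE-correct snd v w = cong suc (enc-right v)
evalE-correct (comp f g) v w =
  trans (ifzE-correct Z (evalE f ∘ₑ ⟨ predE ∘ₑ evalE g , P₂ ⟩ₑ) (evalE g) (node v w))
        (cong₂ (λ a b → ifz a 0 b) (evalE-correct g v w)
               (trans (evalE-correct f (⟦ predE ∘ₑ evalE g ⟧ (node v w)) w)
                      (cong (λ z → eval f z (enc w)) (pred-evalE g v w))))
evalE-correct (pair f g) v w =
  trans (ifzE-correct Z (ifzE Z both (evalE g)) (evalE f) (node v w))
        (cong₂ (λ a b → ifz a 0 b) (evalE-correct f v w)
               (trans (ifzE-correct Z both (evalE g) (node v w))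
                      (cong₂ (λ a b → ifz a 0 b) (evalE-correct g v w)
                             (cong suc (cong₂ ⟪_,_⟫ (pred-evalE f v w) (pred-evalE g v w))))))
  where
  both : Expr
  both = S ∘ₑ ⟨ predE ∘ₑ evalE f , predE ∘ₑ evalE g ⟩ₑ
evalE-correct (rec f g) v w =
  trans (enc-treeRec _ _ _ step (enc (right v)))
        (trans (cong (λ b → primRec b (λ m y → ifz y 0 (eval g ⟪ ⟪ enc a , m ⟫ , pred y ⟫ (enc w)))
                                     (enc (right v)))
                     (evalE-correct f a w))
               (cong₂ (λ x n → evalRec f g x n (enc w)) (enc-left v) (enc-right v)))
  where
  a : Tree
  a = left v
  step : ∀ m y → ⟦ recStepE g ⟧ₙ (node (node (node a w) (leaf m)) y) ≡
                 ifz (enc y) 0 (eval g ⟪ ⟪ enc a , m ⟫ , pred (enc y) ⟫ (enc w))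
  step m y =
    trans (ifzE-correct Z (evalE g ∘ₑ ⟨ ⟨ ⟨ P₁ ∘ₑ P₁ ∘ₑ P₁ , P₂ ∘ₑ P₁ ⟩ₑ , predE ∘ₑ P₂ ⟩ₑ , P₂ ∘ₑ P₁ ∘ₑ P₁ ⟩ₑ) P₂
                        (node (node (node a w) (leaf m)) y))
          (cong (ifz (enc y) 0)
                (trans (evalE-correct g (node (node a (leaf m)) (⟦ predE ⟧ y)) w)
                       (cong (λ z → eval g ⟪ ⟪ enc a , m ⟫ , z ⟫ (enc w)) (predE-correct y))))
evalE-correct (mu f) v w =
  trans (ifzE-correct Z (ifzE Z (muSearchE f) found) (muSearchE f) (node v w))
        (cong₂ (λ r q → ifz r 0 q) stop-ok
               (trans (ifzE-correct Z (muSearchE f) found (node v w))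
                      (cong₂ (λ q r → ifz q 0 r) found-ok stop-ok)))
  where
  found : Expr
  found = evalE f ∘ₑ ⟨ ⟨ P₁ , predE ∘ₑ muSearchE f ⟩ₑ , P₂ ⟩ₑ
  stop : ℕ
  stop = muStop (λ j → eval f ⟪ enc v , j ⟫ (enc w)) (enc w)
  stop-ok : ⟦ muSearchE f ⟧ₙ (node v w) ≡ stop
  stop-ok = muSearchE-correct f v w
  found-ok : ⟦ found ⟧ₙ (node v w) ≡ eval f ⟪ enc v , pred stop ⟫ (enc w)
  found-ok =
    trans (evalE-correct f (node v (⟦ predE ∘ₑ muSearchE f ⟧ (node v w))) w)
          (cong (λ z → eval f ⟪ enc v , z ⟫ (enc w))
                (trans (predE-correct (⟦ muSearchE f ⟧ (node v w))) (cong pred stop-ok)))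

boolToℕ : Bool → ℕ
boolToℕ false = 0
boolToℕ true  = 1

bit0 : ∀ x → bit 0 x ≡ false
bit0 zero    = refl
bit0 (suc x) = bit0 x

⌊1+n/2⌋ : ∀ n → ⌊ suc n /2⌋ ≡ ⌊ n /2⌋ + boolToℕ (odd n)
⌊1+n/2⌋ zero          = refl
⌊1+n/2⌋ (suc zero)    = refl
⌊1+n/2⌋ (suc (suc n)) rewrite not-involutive (odd n) = cong suc (⌊1+n/2⌋ n)

n+2a≡2+n+2[a-1] : ∀ n a → n + (suc a + (suc a + 0)) ≡ suc (suc (n + (a + (a + 0))))
n+2a≡2+n+2[a-1] n a rewrite +-suc a (a + 0) | +-suc n (suc (a + (a + 0))) | +-suc n (a + (a + 0)) = refl

odd-+-double : ∀ n a → odd (n + (a + (a + 0))) ≡ odd n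
odd-+-double n zero    rewrite +-identityʳ n = refl
odd-+-double n (suc a) rewrite n+2a≡2+n+2[a-1] n a | not-involutive (odd (n + (a + (a + 0)))) = odd-+-double n a

⌊n+double/2⌋ : ∀ n a → ⌊ n + (a + (a + 0)) /2⌋ ≡ ⌊ n /2⌋ + a
⌊n+double/2⌋ n zero    rewrite +-identityʳ n | +-identityʳ ⌊ n /2⌋ = refl
⌊n+double/2⌋ n (suc a) rewrite n+2a≡2+n+2[a-1] n a | ⌊n+double/2⌋ n a = sym (+-suc ⌊ n /2⌋ a)

bit-+2^-same : ∀ x n → bit n x ≡ false → bit (n + 2 ^ x) x ≡ true
bit-+2^-same zero    n e rewrite +-comm n 1 | e = refl
bit-+2^-same (suc x) n e rewrite ⌊n+double/2⌋ n (2 ^ x) = bit-+2^-same x ⌊ n /2⌋ e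

bit-+2^-other : ∀ x n → bit n x ≡ false → ∀ y → y ≢ x → bit (n + 2 ^ x) y ≡ bit n y
bit-+2^-other zero    n e zero    y≢x = ⊥-elim (y≢x refl)
bit-+2^-other zero    n e (suc y) _
  rewrite +-comm n 1 | ⌊1+n/2⌋ n | e | +-identityʳ ⌊ n /2⌋ = refl
bit-+2^-other (suc x) n e zero    _   = odd-+-double n (2 ^ x)
bit-+2^-other (suc x) n e (suc y) y≢x rewrite ⌊n+double/2⌋ n (2 ^ x) =
  bit-+2^-other x ⌊ n /2⌋ e y (λ y≡x → y≢x (cong suc y≡x))

bit-addElem : ∀ z n y → bit (addElem z n) y ≡ true ⇔ (y ≡ z ⊎ bit n y ≡ true)
bit-addElem z n y = mk⇔ to from
  where
  to : bit (addElem z n) y ≡ true → y ≡ z ⊎ bit n y ≡ true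
  to e with bit n z in ez
  ... | true  = inj₂ e
  ... | false with y ≟ z
  ...   | yes y≡z = inj₁ y≡z
  ...   | no  y≢z = inj₂ (trans (sym (bit-+2^-other z n ez y y≢z)) e)
  from : y ≡ z ⊎ bit n y ≡ true → bit (addElem z n) y ≡ true
  from h with bit n z in ez
  from (inj₁ refl) | true  = ez
  from (inj₂ b)    | true  = b
  from (inj₁ refl) | false = bit-+2^-same z n ez
  from (inj₂ b)    | false with y ≟ z
  ... | yes refl = bit-+2^-same z n ez
  ... | no  y≢z  = trans (bit-+2^-other z n ez y y≢z) b

bit⇒2^≤ : ∀ x n → bit n x ≡ true → 2 ^ x ≤ n
bit⇒2^≤ zero    (suc n) e = s≤s z≤n
bit⇒2^≤ (suc x) n       e rewrite +-identityʳ (2 ^ x) =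
  ≤-trans (+-mono-≤ (bit⇒2^≤ x ⌊ n /2⌋ e) (bit⇒2^≤ x ⌊ n /2⌋ e))
          (≤-trans (+-monoʳ-≤ ⌊ n /2⌋ (⌊n/2⌋≤⌈n/2⌉ n)) (≤-reflexive (⌊n/2⌋+⌈n/2⌉≡n n)))

n<2^n : ∀ n → n < 2 ^ n
n<2^n zero    = s≤s z≤n
n<2^n (suc n) rewrite +-identityʳ (2 ^ n) =
  subst (_< 2 ^ n + 2 ^ n) (+-comm n 1) (+-mono-<-≤ (n<2^n n) (≤-trans (s≤s z≤n) (n<2^n n)))

bit⇒< : ∀ x n → bit n x ≡ true → x < n
bit⇒< x n e = <-≤-trans (n<2^n x) (bit⇒2^≤ x n e)

bit-setCode : ∀ l x → bit (setCode l) x ≡ true ⇔ just x ∈ l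
bit-setCode l x = mk⇔ (to l) (from l)
  where
  to : ∀ l → bit (setCode l) x ≡ true → just x ∈ l
  to []            e rewrite bit0 x with () ← e
  to (nothing ∷ l) e = there (to l e)
  to (just z ∷ l)  e with Equivalence.to (bit-addElem z (setCode l) x) e
  ... | inj₁ refl = here refl
  ... | inj₂ b    = there (to l b)
  from : ∀ l → just x ∈ l → bit (setCode l) x ≡ true
  from (just z ∷ l)  (here refl) = Equivalence.from (bit-addElem x (setCode l) x) (inj₁ refl)
  from (nothing ∷ l) (there i)   = from l i
  from (just z ∷ l)  (there i)   = Equivalence.from (bit-addElem z (setCode l) x) (inj₂ (from l i))

∈-prefix : ∀ T i x → just x ∈ prefix T i ⇔ (Σ ℕ λ n → n < i × T n ≡ just x)
∈-prefix T i x = mk⇔ (to i) (λ (n , n<i , Tn) → from i n n<i Tn)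
  where
  to : ∀ i → just x ∈ prefix T i → Σ ℕ λ n → n < i × T n ≡ just x
  to (suc i) (here Ti)  = i , ≤-refl , sym Ti
  to (suc i) (there x∈) with to i x∈
  ... | n , n<i , Tn = n , m<n⇒m<1+n n<i , Tn
  from : ∀ i n → n < i → T n ≡ just x → just x ∈ prefix T i
  from (suc i) n (s≤s n≤i) Tn with m≤n⇒m<n∨m≡n n≤i
  ... | inj₁ n<i  = there (from i n n<i Tn)
  ... | inj₂ refl = here (sym Tn)

bit-contentCode : ∀ T i x → bit (contentCode T i) x ≡ true ⇔ (Σ ℕ λ n → n < i × T n ≡ just x)
bit-contentCode T i x = ⇔-trans (bit-setCode (prefix T i) x) (∈-prefix T i x)

ifz-boolToℕ : ∀ β (p q : ℕ) → ifz (boolToℕ β) p q ≡ (if β then q else p)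
ifz-boolToℕ false p q = refl
ifz-boolToℕ true  p q = refl

oddE : Expr
oddE = R Z (isZeroE P₂) ∘ₑ ⟨ Z , I ⟩ₑ

oddE-correct : ∀ v → ⟦ oddE ⟧ₙ v ≡ boolToℕ (odd (enc v))
oddE-correct v =
  trans (enc-treeRec (leaf 0) _ (λ _ y → isZero y)
                     (λ m y → isZeroE-correct P₂ (node (node (leaf 0) (leaf m)) y)) (enc v))
        (go (enc v))
  where
  go : ∀ n → primRec 0 (λ _ y → isZero y) n ≡ boolToℕ (odd n)
  go zero = refl
  go (suc n) rewrite go n with odd n
  ... | false = refl
  ... | true  = refl

halfE : Expr
halfE = R Z (addE ∘ₑ ⟨ P₂ , oddE ∘ₑ P₂ ∘ₑ P₁ ⟩ₑ) ∘ₑ ⟨ Z , I ⟩ₑ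

halfE-correct : ∀ v → ⟦ halfE ⟧ₙ v ≡ ⌊ enc v /2⌋
halfE-correct v =
  trans (enc-treeRec (leaf 0) _ (λ m y → y + boolToℕ (odd m))
           (λ m y → trans (addE-correct y (⟦ oddE ⟧ (leaf m))) (cong (enc y +_) (oddE-correct (leaf m)))) (enc v))
        (go (enc v))
  where
  go : ∀ n → primRec 0 (λ m y → y + boolToℕ (odd m)) n ≡ ⌊ n /2⌋
  go zero    = refl
  go (suc n) = trans (cong (_+ boolToℕ (odd n)) (go n)) (sym (⌊1+n/2⌋ n))

pow2E : Expr
pow2E = R (K 1) (addE ∘ₑ ⟨ P₂ , P₂ ⟩ₑ) ∘ₑ ⟨ Z , I ⟩ₑ

pow2E-correct : ∀ v → ⟦ pow2E ⟧ₙ v ≡ 2 ^ enc v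
pow2E-correct v = trans (enc-treeRec (leaf 1) _ (λ _ y → y + y) (λ _ y → addE-correct y y) (enc v)) (go (enc v))
  where
  go : ∀ n → primRec 1 (λ _ y → y + y) n ≡ 2 ^ n
  go zero    = refl
  go (suc n) = trans (cong (λ y → y + y) (go n)) (cong (2 ^ n +_) (sym (+-identityʳ (2 ^ n))))

triE : Expr
triE = R Z (addE ∘ₑ ⟨ P₂ , S ∘ₑ P₂ ∘ₑ P₁ ⟩ₑ) ∘ₑ ⟨ Z , I ⟩ₑ

triE-correct : ∀ v → ⟦ triE ⟧ₙ v ≡ tri (enc v)
triE-correct v =
  trans (enc-treeRec (leaf 0) _ (λ m y → y + suc m) (λ m y → addE-correct y (leaf (suc m))) (enc v)) (go (enc v))
  where
  go : ∀ n → primRec 0 (λ m y → y + suc m) n ≡ tri n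
  go zero    = refl
  go (suc n) = cong (_+ suc n) (go n)

cantorE : Expr
cantorE = addE ∘ₑ ⟨ triE ∘ₑ addE , P₁ ⟩ₑ

cantorE-correct : ∀ a b → ⟦ cantorE ⟧ₙ (node a b) ≡ ⟪ enc a , enc b ⟫
cantorE-correct a b =
  trans (addE-correct (⟦ triE ∘ₑ addE ⟧ (node a b)) a)
        (cong (_+ enc a) (trans (triE-correct (⟦ addE ⟧ (node a b))) (cong tri (addE-correct a b))))

halvings : ℕ → ℕ → ℕ
halvings n = primRec n (λ _ y → ⌊ y /2⌋)

halvings-suc : ∀ n x → halvings n (suc x) ≡ halvings ⌊ n /2⌋ x
halvings-suc n zero    = refl
halvings-suc n (suc x) = cong ⌊_/2⌋ (halvings-suc n x)

odd-halvings : ∀ n x → odd (halvings n x) ≡ bit n x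
odd-halvings n zero    = refl
odd-halvings n (suc x) = trans (cong odd (halvings-suc n x)) (odd-halvings ⌊ n /2⌋ x)

bitE : Expr
bitE = oddE ∘ₑ R I (halfE ∘ₑ P₂)

bitE-correct : ∀ a b → ⟦ bitE ⟧ₙ (node a b) ≡ boolToℕ (bit (enc a) (enc b))
bitE-correct a b =
  trans (oddE-correct (⟦ R I (halfE ∘ₑ P₂) ⟧ (node a b)))
        (trans (cong (boolToℕ ∘ odd) (enc-treeRec a _ (λ _ y → ⌊ y /2⌋) (λ _ y → halfE-correct y) (enc b)))
               (cong boolToℕ (odd-halvings (enc a) (enc b))))

addElemE : Expr
addElemE = ifzE (addE ∘ₑ ⟨ P₂ , pow2E ∘ₑ P₁ ⟩ₑ) P₂ (bitE ∘ₑ ⟨ P₂ , P₁ ⟩ₑ)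

addElemE-correct : ∀ a b → ⟦ addElemE ⟧ₙ (node a b) ≡ addElem (enc a) (enc b)
addElemE-correct a b =
  trans (ifzE-correct (addE ∘ₑ ⟨ P₂ , pow2E ∘ₑ P₁ ⟩ₑ) P₂ (bitE ∘ₑ ⟨ P₂ , P₁ ⟩ₑ) (node a b))
        (trans (cong₂ (λ c s → ifz c s (enc b)) (bitE-correct b a)
                      (trans (addE-correct b (⟦ pow2E ⟧ a)) (cong (enc b +_) (pow2E-correct a))))
               (ifz-boolToℕ (bit (enc b) (enc a)) (enc b + 2 ^ enc a) (enc b)))

segmentCode : ℕ → ℕ → ℕ
segmentCode k = primRec 0 (λ m y → addElem ⟪ k , m ⟫ y)

segmentE : Expr
segmentE = R Z (addElemE ∘ₑ ⟨ cantorE ∘ₑ ⟨ P₁ ∘ₑ P₁ , P₂ ∘ₑ P₁ ⟩ₑ , P₂ ⟩ₑ)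

segmentE-correct : ∀ a b → ⟦ segmentE ⟧ₙ (node a b) ≡ segmentCode (enc a) (enc b)
segmentE-correct a b = enc-treeRec (leaf 0) _ (λ m y → addElem ⟪ enc a , m ⟫ y) step (enc b)
  where
  step : ∀ m y → ⟦ addElemE ⟧ₙ (node (⟦ cantorE ⟧ (node a (leaf m))) y) ≡ addElem ⟪ enc a , m ⟫ (enc y)
  step m y = trans (addElemE-correct (⟦ cantorE ⟧ (node a (leaf m))) y)
                   (cong (λ z → addElem z (enc y)) (cantorE-correct a (leaf m)))

-- The key of a nonempty finite set is the first component of its least element.
keyOf : ℕ → ℕ
keyOf c = π₁ (pred (search (boolToℕ ∘ bit c) c))

keyE : Expr
keyE = P₁ ∘ₑ predE ∘ₑ searchE bitE ∘ₑ ⟨ P₁ , P₁ ⟩ₑ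

keyE-correct : ∀ c w → ⟦ keyE ⟧ₙ (node (leaf c) w) ≡ keyOf c
keyE-correct c w =
  trans (enc-left (⟦ predE ⟧ found))
        (cong π₁ (trans (predE-correct found)
                        (cong pred (trans (searchE-correct bitE (leaf c) (leaf c))
                                          (search-cong _ _ c (λ j → bitE-correct (leaf c) (leaf j)))))))
  where
  found : Tree
  found = ⟦ searchE bitE ⟧ (node (leaf c) (leaf c))

boolToℕ≢0 : ∀ β → boolToℕ β ≢ 0 → β ≡ true
boolToℕ≢0 false ≢0 = ⊥-elim (≢0 refl)
boolToℕ≢0 true  _  = refl

keyOf-member : ∀ c x → bit c x ≡ true → Σ ℕ λ y → bit c y ≡ true × keyOf c ≡ π₁ y
keyOf-member c x bx with search-nonzero (boolToℕ ∘ bit c) c x (λ ≡0 → 1+n≢0 (subst (λ β → boolToℕ β ≡ 0) bx ≡0))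
                                        (bit⇒< x c bx)
... | y , found = y , boolToℕ≢0 _ (proj₁ (proj₂ (search≡1+j⇒least _ c y found))) , cong (π₁ ∘ pred) found

keyOf-stabilises : ∀ T k → content T ⟪ k , 0 ⟫ → (∀ x → content T x → π₁ x ≡ k) →
                   Eventually (λ i → keyOf (contentCode T i) ≡ k)
keyOf-stabilises T k (n , Tn) keyed = suc n , λ i n<i → stable i n<i
  where
  stable : ∀ i → n < i → keyOf (contentCode T i) ≡ k
  stable i n<i with keyOf-member (contentCode T i) ⟪ k , 0 ⟫
                      (Equivalence.from (bit-contentCode T i ⟪ k , 0 ⟫) (n , n<i , Tn))
  ... | y , by , key≡ with Equivalence.to (bit-contentCode T i y) by
  ...   | m , _ , Tm = trans key≡ (keyed y (m , Tm))

dist : ℕ → ℕ → ℕ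
dist a b = (a ∸ b) + (b ∸ a)

dist≡0⇒≡ : ∀ a b → dist a b ≡ 0 → a ≡ b
dist≡0⇒≡ a b e = ≤-antisym (m∸n≡0⇒m≤n (m+n≡0⇒m≡0 (a ∸ b) e)) (m∸n≡0⇒m≤n (m+n≡0⇒n≡0 (a ∸ b) e))

dist-refl : ∀ a → dist a a ≡ 0
dist-refl a rewrite n∸n≡0 a = refl

distE : Expr → Expr → Expr
distE a b = addE ∘ₑ ⟨ monusE ∘ₑ ⟨ a , b ⟩ₑ , monusE ∘ₑ ⟨ b , a ⟩ₑ ⟩ₑ

distE-correct : ∀ a b v → ⟦ distE a b ⟧ₙ v ≡ dist (⟦ a ⟧ₙ v) (⟦ b ⟧ₙ v)
distE-correct a b v =
  trans (addE-correct (⟦ monusE ⟧ (node (⟦ a ⟧ v) (⟦ b ⟧ v))) (⟦ monusE ⟧ (node (⟦ b ⟧ v) (⟦ a ⟧ v))))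
        (cong₂ _+_ (monusE-correct (⟦ a ⟧ v) (⟦ b ⟧ v)) (monusE-correct (⟦ b ⟧ v) (⟦ a ⟧ v)))

Stream : ℕ → SetN
Stream k x = Σ ℕ λ m → x ≡ ⟪ k , m ⟫

Segment : ℕ → ℕ → SetN
Segment k n x = Σ ℕ λ m → m ≤ n × x ≡ ⟪ k , m ⟫

Lang : ℕ → ℕ → SetN
Lang k zero    = Stream k
Lang k (suc n) = Segment k n

Lang-key : ∀ k f x → Lang k f x → π₁ x ≡ k
Lang-key k zero    x (m , refl)     = π₁-⟪⟫ k m
Lang-key k (suc n) x (m , _ , refl) = π₁-⟪⟫ k m

Lang-origin : ∀ k f → Lang k f ⟪ k , 0 ⟫
Lang-origin k zero    = 0 , refl
Lang-origin k (suc n) = 0 , z≤n , refl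

χ : ℕ → ℕ → ℕ → ℕ
χ k f x = ifz (dist (π₁ x) k) (ifz f 1 (isZero (π₂ x ∸ pred f))) 0

χ≤1 : ∀ k f x → χ k f x ≤ 1
χ≤1 k f x with dist (π₁ x) k
... | suc _ = z≤n
... | zero with f
...   | zero = ≤-refl
...   | suc n with π₂ x ∸ n
...     | zero  = ≤-refl
...     | suc _ = z≤n

χ≡1⇔Lang : ∀ k f x → (χ k f x ≡ 1) ⇔ Lang k f x
χ≡1⇔Lang k f x = mk⇔ (to f) (from f)
  where
  on-stream : ∀ m → x ≡ ⟪ k , m ⟫ → dist (π₁ x) k ≡ 0 × π₂ x ≡ m
  on-stream m refl = trans (cong (λ a → dist a k) (π₁-⟪⟫ k m)) (dist-refl k) , π₂-⟪⟫ k m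
  to : ∀ f → χ k f x ≡ 1 → Lang k f x
  to f e with dist (π₁ x) k in eq | e
  ... | zero | e′ with f | e′
  ...   | zero  | _ = π₂ x , trans (sym (⟪π₁,π₂⟫ x)) (cong (λ z → ⟪ z , π₂ x ⟫) (dist≡0⇒≡ (π₁ x) k eq))
  ...   | suc n | e″ with π₂ x ∸ n in eq₂ | e″
  ...     | zero | _ = π₂ x , m∸n≡0⇒m≤n eq₂
                     , trans (sym (⟪π₁,π₂⟫ x)) (cong (λ z → ⟪ z , π₂ x ⟫) (dist≡0⇒≡ (π₁ x) k eq))
  from : ∀ f → Lang k f x → χ k f x ≡ 1
  from zero    (m , x≡)       rewrite proj₁ (on-stream m x≡) = refl
  from (suc n) (m , m≤n , x≡) rewrite proj₁ (on-stream m x≡) | proj₂ (on-stream m x≡) | m≤n⇒m∸n≡0 m≤n = refl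

withinE : Expr
withinE = isZeroE (monusE ∘ₑ ⟨ P₂ ∘ₑ P₂ , predE ∘ₑ P₂ ∘ₑ P₁ ⟩ₑ)

χE : Expr
χE = ifzE (ifzE (K 1) withinE (P₂ ∘ₑ P₁)) Z (distE (P₁ ∘ₑ P₂) (P₁ ∘ₑ P₁))

χE-correct : ∀ p x → ⟦ χE ⟧ₙ (node p x) ≡ χ (π₁ (enc p)) (π₂ (enc p)) (enc x)
χE-correct p x =
  trans (ifzE-correct (ifzE (K 1) withinE (P₂ ∘ₑ P₁)) Z (distE (P₁ ∘ₑ P₂) (P₁ ∘ₑ P₁)) v)
        (cong₂ (λ a b → ifz a b 0) key-ok
               (trans (ifzE-correct (K 1) withinE (P₂ ∘ₑ P₁) v)
                      (cong₂ (λ a b → ifz a 1 b) (enc-right p) within-ok)))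
  where
  v : Tree
  v = node p x
  key-ok : ⟦ distE (P₁ ∘ₑ P₂) (P₁ ∘ₑ P₁) ⟧ₙ v ≡ dist (π₁ (enc x)) (π₁ (enc p))
  key-ok = trans (distE-correct (P₁ ∘ₑ P₂) (P₁ ∘ₑ P₁) v) (cong₂ dist (enc-left x) (enc-left p))
  within-ok : ⟦ withinE ⟧ₙ v ≡ isZero (π₂ (enc x) ∸ pred (π₂ (enc p)))
  within-ok =
    trans (isZeroE-correct (monusE ∘ₑ ⟨ P₂ ∘ₑ P₂ , predE ∘ₑ P₂ ∘ₑ P₁ ⟩ₑ) v)
          (cong isZero (trans (monusE-correct (right x) (⟦ predE ⟧ (right p)))
                              (cong₂ _∸_ (enc-right x) (trans (predE-correct (right p)) (cong pred (enc-right p))))))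

-- Overshoot stages

module Overshoot (u : Code) where

  -- Within t steps, program k conjectures some e on the code of ⟪ k , 0 ⟫ … ⟪ k , n ⟫, and e halts
  -- on ⟪ k , m ⟫; the value is then nonzero iff m > n.
  overshootAt : ℕ → ℕ → ℕ → ℕ → ℕ
  overshootAt k n m t = ifz r₁ 0 (ifz (eval u ⟪ pred r₁ , ⟪ k , m ⟫ ⟫ t) 0 (m ∸ n))
    where
    r₁ : ℕ
    r₁ = eval u ⟪ k , segmentCode k (suc n) ⟫ t

  overshoot : ℕ → ℕ → ℕ
  overshoot k s = overshootAt k (π₁ s) (π₁ (π₂ s)) (π₂ (π₂ s))

  overshoot-⟪⟫ : ∀ k n m t → overshoot k ⟪ n , ⟪ m , t ⟫ ⟫ ≡ overshootAt k n m t
  overshoot-⟪⟫ k n m t rewrite π₁-⟪⟫ n ⟪ m , t ⟫ | π₂-⟪⟫ n ⟪ m , t ⟫ | π₁-⟪⟫ m t | π₂-⟪⟫ m t = refl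

  nE mE tE conjectureE acceptsE overshootE : Expr
  nE = P₁ ∘ₑ P₂
  mE = P₁ ∘ₑ P₂ ∘ₑ P₂
  tE = P₂ ∘ₑ P₂ ∘ₑ P₂
  conjectureE = evalE u ∘ₑ ⟨ ⟨ P₁ , segmentE ∘ₑ ⟨ P₁ , S ∘ₑ nE ⟩ₑ ⟩ₑ , tE ⟩ₑ
  acceptsE    = evalE u ∘ₑ ⟨ ⟨ predE ∘ₑ conjectureE , cantorE ∘ₑ ⟨ P₁ , mE ⟩ₑ ⟩ₑ , tE ⟩ₑ
  overshootE  = ifzE Z (ifzE Z (monusE ∘ₑ ⟨ mE , nE ⟩ₑ) acceptsE) conjectureE

  overshootE-correct : ∀ a b → ⟦ overshootE ⟧ₙ (node a b) ≡ overshoot (enc a) (enc b)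
  overshootE-correct a b =
    trans (ifzE-correct Z (ifzE Z (monusE ∘ₑ ⟨ mE , nE ⟩ₑ) acceptsE) conjectureE v)
          (cong₂ (λ x y → ifz x 0 y) conjecture-ok
                 (trans (ifzE-correct Z (monusE ∘ₑ ⟨ mE , nE ⟩ₑ) acceptsE v)
                        (cong₂ (λ x y → ifz x 0 y) accepts-ok
                               (trans (monusE-correct (⟦ mE ⟧ v) (⟦ nE ⟧ v)) (cong₂ _∸_ m-ok n-ok)))))
    where
    v : Tree
    v = node a b
    s : ℕ
    s = enc b
    n-ok : ⟦ nE ⟧ₙ v ≡ π₁ s
    n-ok = enc-left b
    m-ok : ⟦ mE ⟧ₙ v ≡ π₁ (π₂ s)
    m-ok = trans (enc-left (right b)) (cong π₁ (enc-right b))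
    t-ok : ⟦ tE ⟧ₙ v ≡ π₂ (π₂ s)
    t-ok = trans (enc-right (right b)) (cong π₂ (enc-right b))
    conjecture-ok : ⟦ conjectureE ⟧ₙ v ≡ eval u ⟪ enc a , segmentCode (enc a) (suc (π₁ s)) ⟫ (π₂ (π₂ s))
    conjecture-ok =
      trans (evalE-correct u (node a (⟦ segmentE ⟧ (node a (⟦ S ∘ₑ nE ⟧ v)))) (⟦ tE ⟧ v))
            (cong₂ (λ x t → eval u ⟪ enc a , x ⟫ t)
                   (trans (segmentE-correct a (⟦ S ∘ₑ nE ⟧ v)) (cong (segmentCode (enc a) ∘ suc) n-ok))
                   t-ok)
    accepts-ok : ⟦ acceptsE ⟧ₙ v ≡
                 eval u ⟪ pred (eval u ⟪ enc a , segmentCode (enc a) (suc (π₁ s)) ⟫ (π₂ (π₂ s)))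
                        , ⟪ enc a , π₁ (π₂ s) ⟫ ⟫ (π₂ (π₂ s))
    accepts-ok =
      trans (evalE-correct u (node (⟦ predE ∘ₑ conjectureE ⟧ v) (⟦ cantorE ⟧ (node a (⟦ mE ⟧ v)))) (⟦ tE ⟧ v))
            (cong₂ (λ x t → eval u x t)
                   (cong₂ ⟪_,_⟫ (trans (predE-correct (⟦ conjectureE ⟧ v)) (cong pred conjecture-ok))
                                (trans (cantorE-correct a (⟦ mE ⟧ v)) (cong ⟪ enc a ,_⟫ m-ok)))
                   t-ok)

  overshoot-witness : ∀ k n m e y → u ∶ ⟪ k , segmentCode k (suc n) ⟫ ↦ e → u ∶ ⟪ e , ⟪ k , m ⟫ ⟫ ↦ y →
                      n < m → Σ ℕ λ s → overshoot k s ≢ 0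
  overshoot-witness k n m e y conj acc n<m with eventually-× (eval-complete conj) (eval-complete acc)
  ... | t , both =
    ⟪ n , ⟪ m , t ⟫ ⟫ , λ ≡0 → m>n⇒m∸n≢0 n<m (trans (sym (at-t (proj₁ (both t ≤-refl)) (proj₂ (both t ≤-refl)))) ≡0)
    where
    at-t : eval u ⟪ k , segmentCode k (suc n) ⟫ t ≡ suc e → eval u ⟪ e , ⟪ k , m ⟫ ⟫ t ≡ suc y →
           overshoot k ⟪ n , ⟪ m , t ⟫ ⟫ ≡ m ∸ n
    at-t e₁ e₂ rewrite overshoot-⟪⟫ k n m t | e₁ | e₂ = refl

  overshoot≢0⇒witness : ∀ k s → overshoot k s ≢ 0 → Σ ℕ λ e → Σ ℕ λ m → Σ ℕ λ y →
    u ∶ ⟪ k , segmentCode k (suc (π₁ s)) ⟫ ↦ e × u ∶ ⟪ e , ⟪ k , m ⟫ ⟫ ↦ y × π₁ s < m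
  overshoot≢0⇒witness k s ≢0 with eval u ⟪ k , segmentCode k (suc (π₁ s)) ⟫ (π₂ (π₂ s)) in e₁ | ≢0
  ... | zero  | ≢0′ = ⊥-elim (≢0′ refl)
  ... | suc e | ≢0′ with eval u ⟪ e , ⟪ k , π₁ (π₂ s) ⟫ ⟫ (π₂ (π₂ s)) in e₂ | ≢0′
  ...   | zero  | ≢0″ = ⊥-elim (≢0″ refl)
  ...   | suc y | ≢0″ = e , π₁ (π₂ s) , y , eval-sound u _ _ e e₁ , eval-sound u _ _ y e₂
                      , m∸n≢0⇒n<m ≢0″

  tag : ℕ → ℕ → ℕ
  tag k i = ifz r 0 (suc (π₁ (pred r)))
    where
    r : ℕ
    r = search (overshoot k) i

  firstOvershootE tagE guessE : Expr
  firstOvershootE = searchE overshootE ∘ₑ ⟨ keyE , P₂ ⟩ₑ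
  tagE            = ifzE Z (S ∘ₑ P₁ ∘ₑ predE ∘ₑ firstOvershootE) firstOvershootE
  guessE          = ⟨ keyE , tagE ⟩ₑ

  firstOvershootE-correct : ∀ c i → ⟦ firstOvershootE ⟧ₙ (node (leaf c) (leaf i)) ≡ search (overshoot (keyOf c)) i
  firstOvershootE-correct c i =
    trans (searchE-correct overshootE key (leaf i))
          (trans (search-cong _ _ i (λ j → overshootE-correct key (leaf j)))
                 (cong (λ k → search (overshoot k) i) (keyE-correct c (leaf i))))
    where
    key : Tree
    key = ⟦ keyE ⟧ (node (leaf c) (leaf i))

  guessE-correct : ∀ c i → ⟦ guessE ⟧ₙ (node (leaf c) (leaf i)) ≡ ⟪ keyOf c , tag (keyOf c) i ⟫
  guessE-correct c i =
    cong₂ ⟪_,_⟫ (keyE-correct c (leaf i))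
      (trans (ifzE-correct Z (S ∘ₑ P₁ ∘ₑ predE ∘ₑ firstOvershootE) firstOvershootE v)
             (cong₂ (λ x y → ifz x 0 y) (firstOvershootE-correct c i)
                    (cong suc (trans (enc-left (⟦ predE ∘ₑ firstOvershootE ⟧ v))
                                     (cong π₁ (trans (predE-correct (⟦ firstOvershootE ⟧ v))
                                                     (cong pred (firstOvershootE-correct c i))))))))
    where
    v : Tree
    v = node (leaf c) (leaf i)

  -- f is the tag that the guesses for key k converge to.
  LimitTag : ℕ → ℕ → Set
  LimitTag k zero    = ∀ s → overshoot k s ≡ 0
  LimitTag k (suc n) = Σ ℕ λ s → overshoot k s ≢ 0 × (∀ s′ → s′ < s → overshoot k s′ ≡ 0) × π₁ s ≡ n

  tag-stabilises : ∀ k f → LimitTag k f → Eventually (λ i → tag k i ≡ f)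
  tag-stabilises k zero none = 0 , λ i _ → stable i
    where
    stable : ∀ i → tag k i ≡ 0
    stable i rewrite zeros⇒search≡0 (overshoot k) i (λ s _ → none s) = refl
  tag-stabilises k (suc n) (s , ≢0 , below , π₁s≡n) = suc s , stable
    where
    stable : ∀ i → s < i → tag k i ≡ suc n
    stable i s<i rewrite least⇒search≡1+j (overshoot k) i s s<i ≢0 below = cong suc π₁s≡n

stream : ℕ → Text
stream k j = just ⟪ k , j ⟫

segmentText : ℕ → ℕ → Text
segmentText k n j with j ≤? n
... | yes _ = just ⟪ k , j ⟫
... | no  _ = nothing

stream-text : ∀ k → TextFor (stream k) (Stream k)
stream-text k x = mk⇔ (λ (m , e) → m , sym (just-injective e)) (λ (m , e) → m , cong just (sym e))

segmentText-≤ : ∀ k n j → j ≤ n → segmentText k n j ≡ just ⟪ k , j ⟫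
segmentText-≤ k n j j≤n with j ≤? n
... | yes _   = refl
... | no  j≰n = ⊥-elim (j≰n j≤n)

segmentText-> : ∀ k n j → n < j → segmentText k n j ≡ nothing
segmentText-> k n j n<j with j ≤? n
... | yes j≤n = ⊥-elim (<⇒≱ n<j j≤n)
... | no  _   = refl

segmentText-text : ∀ k n → TextFor (segmentText k n) (Segment k n)
segmentText-text k n x = mk⇔ to (λ (m , m≤n , e) → m , trans (segmentText-≤ k n m m≤n) (cong just (sym e)))
  where
  to : content (segmentText k n) x → Segment k n x
  to (j , e) with j ≤? n | e
  ... | yes j≤n | refl = j , j≤n , refl

contentCode-stream : ∀ k n → contentCode (stream k) n ≡ segmentCode k n
contentCode-stream k zero    = refl
contentCode-stream k (suc n) = cong (addElem ⟪ k , n ⟫) (contentCode-stream k n)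

prefix-cong : ∀ T T′ N → (∀ j → j < N → T j ≡ T′ j) → prefix T N ≡ prefix T′ N
prefix-cong T T′ zero    _ = refl
prefix-cong T T′ (suc N) h = cong₂ _∷_ (h N ≤-refl) (prefix-cong T T′ N (λ j j<N → h j (m<n⇒m<1+n j<N)))

contentCode-segmentText : ∀ k n r → contentCode (segmentText k n) (r + suc n) ≡ segmentCode k (suc n)
contentCode-segmentText k n zero =
  trans (cong setCode (prefix-cong (segmentText k n) (stream k) (suc n)
                                   (λ j j<1+n → segmentText-≤ k n j (≤-pred j<1+n))))
        (contentCode-stream k (suc n))
contentCode-segmentText k n (suc r)
  rewrite segmentText-> k n (r + suc n) (≤-trans (s≤s (m≤n+m n r)) (≤-reflexive (sym (+-suc r n))))
  = contentCode-segmentText k n r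

-- The separating class

module _ (ψ : Numbering) (acc : Acceptable ψ) where

  open Acceptable acc
  open Equivalence

  u : Code
  u = proj₁ universal

  ψ⇔u : ∀ e x y → ψ e x y ⇔ (u ∶ ⟪ e , x ⟫ ↦ y)
  ψ⇔u = proj₂ universal

  open Overshoot u

  χCode : Code
  χCode = compile χE

  χCode-↦ : ∀ k f x → χCode ∶ ⟪ ⟪ k , f ⟫ , x ⟫ ↦ χ k f x
  χCode-↦ k f x =
    subst (χCode ∶ ⟪ ⟪ k , f ⟫ , x ⟫ ↦_)
          (trans (χE-correct (leaf ⟪ k , f ⟫) (leaf x)) (cong₂ (λ a b → χ a b x) (π₁-⟪⟫ k f) (π₂-⟪⟫ k f)))
          (compile-correct χE (node (leaf ⟪ k , f ⟫) (leaf x)))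

  χIndexer : Code
  χIndexer = proj₁ (smn χCode)

  χIndex : ℕ → ℕ
  χIndex p = proj₁ (proj₂ (smn χCode) p)

  χIndexer-↦ : ∀ p → χIndexer ∶ p ↦ χIndex p
  χIndexer-↦ p = proj₁ (proj₂ (proj₂ (smn χCode) p))

  ψ-χIndex : ∀ k f x y → ψ (χIndex ⟪ k , f ⟫) x y ⇔ (χ k f x ≡ y)
  ψ-χIndex k f x y = ⇔-trans (proj₂ (proj₂ (proj₂ (smn χCode) ⟪ k , f ⟫)) x y) (↦⇔≡ (χCode-↦ k f x) y)

  χIndex-CIndex : ∀ k f → CIndex ψ (χIndex ⟪ k , f ⟫)
  χIndex-CIndex k f x = χ k f x , from (ψ-χIndex k f x (χ k f x)) refl , χ≤1 k f x

  C-χIndex : ∀ k f → C ψ (χIndex ⟪ k , f ⟫) ≐ Lang k f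
  C-χIndex k f x = ⇔-trans (ψ-χIndex k f x 1) (χ≡1⇔Lang k f x)

  𝓛 : Class
  𝓛 L = Lift (lsuc 0ℓ) (Σ ℕ λ k → Σ ℕ λ f → LimitTag k f × L ≐ Lang k f)

  𝓛⊆REC : ∀ L → 𝓛 L → REC ψ L
  𝓛⊆REC L (lift (k , f , _ , L≐)) =
    χIndex ⟪ k , f ⟫ , χIndex-CIndex k f , λ x → ⇔-trans (C-χIndex k f x) (⇔-sym (L≐ x))

  learner : Code
  learner = comp χIndexer (compile guessE)

  learner-↦ : ∀ c i → learner ∶ ⟪ c , i ⟫ ↦ χIndex ⟪ keyOf c , tag (keyOf c) i ⟫
  learner-↦ c i =
    compE (subst (compile guessE ∶ ⟪ c , i ⟫ ↦_) (guessE-correct c i) (compile-correct guessE (node (leaf c) (leaf i))))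
          (χIndexer-↦ _)

  learner-CInd : ∀ T → CInd ψ (Psd learner T) T
  learner-CInd T i = _ , learner-↦ c i , χIndex-CIndex (keyOf c) (tag (keyOf c) i)
    where
    c : ℕ
    c = contentCode T i

  learner-converges : ∀ k f → LimitTag k f → ∀ T → content T ≐ Lang k f → ExC ψ (Psd learner T) T
  learner-converges k f limit T content≐
    with eventually-× (keyOf-stabilises T k (from (content≐ ⟪ k , 0 ⟫) (Lang-origin k f))
                                            (λ x x∈ → Lang-key k f x (to (content≐ x) x∈)))
                      (tag-stabilises k f limit)
  ... | n₀ , stable =
    n₀ , χIndex ⟪ k , f ⟫ , converged , χIndex-CIndex k f , λ x → ⇔-trans (C-χIndex k f x) (⇔-sym (content≐ x))
    where
    converged : ∀ n → n₀ ≤ n → Psd learner T n (χIndex ⟪ k , f ⟫)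
    converged n n₀≤n with stable n n₀≤n
    ... | key≡ , tag≡ =
      subst (Psd learner T n) (cong χIndex (cong₂ ⟪_,_⟫ key≡ (trans (cong (λ k′ → tag k′ n) key≡) tag≡)))
            (learner-↦ (contentCode T n) n)

  learner-ExC : ∀ L → 𝓛 L → ∀ T → TextFor T L → ExC ψ (Psd learner T) T
  learner-ExC L (lift (k , f , limit , L≐)) T T-for = learner-converges k f limit T (λ x → ⇔-trans (T-for x) (L≐ x))

  𝓛-Psd-Ex-learnable : InτCIndTxtPsdExC ψ 𝓛
  𝓛-Psd-Ex-learnable = learner , learner-CInd , learner-ExC

  module Diagonal (h : Code) (learns : ∀ L → 𝓛 L → ∀ T → TextFor T L → BcW ψ (Sd h T) T) where

    k : ℕ
    k = proj₁ (proj₂ (smn (comp h snd)) 0)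

    u-k⇔h : ∀ x y → u ∶ ⟪ k , x ⟫ ↦ y ⇔ h ∶ x ↦ y
    u-k⇔h x y = ⇔-trans (⇔-sym (ψ⇔u k x y))
                        (⇔-trans (proj₂ (proj₂ (proj₂ (smn (comp h snd)) 0)) x y) (comp-snd-↦ h 0 x y))

    stream-refutes : LimitTag k 0 → ⊥
    stream-refutes none with learns (Stream k) (lift (k , 0 , none , λ _ → ⇔-refl)) (stream k) (stream-text k)
    ... | n₀ , bc with bc (suc n₀) (n≤1+n n₀)
    ... | e , guess , W≐ with from (W≐ ⟪ k , suc n₀ ⟫) (suc n₀ , refl)
    ... | y , ψey with overshoot-witness k n₀ (suc n₀) e y
                         (from (u-k⇔h _ e) (subst (λ c → h ∶ c ↦ e) (contentCode-stream k (suc n₀)) guess))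
                         (to (ψ⇔u e _ y) ψey) ≤-refl
    ... | s , ≢0 = ≢0 (none s)

    segment-refutes : ∀ s → overshoot k s ≢ 0 → (∀ s′ → s′ < s → overshoot k s′ ≡ 0) → ⊥
    segment-refutes s ≢0 below with overshoot≢0⇒witness k s ≢0
    ... | e′ , m , y , conj , accepts , n<m
      with learns (Segment k (π₁ s)) (lift (k , suc (π₁ s) , (s , ≢0 , below , refl) , λ _ → ⇔-refl))
                  (segmentText k (π₁ s)) (segmentText-text k (π₁ s))
    ... | n₀ , bc with bc (n₀ + suc (π₁ s)) (m≤m+n n₀ (suc (π₁ s)))
    ... | e , guess , W≐ with ↦-functional (to (u-k⇔h _ e′) conj)
                                           (subst (λ c → h ∶ c ↦ e) (contentCode-segmentText k (π₁ s) n₀) guess)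
    ... | refl with to (segmentText-text k (π₁ s) ⟪ k , m ⟫) (to (W≐ ⟪ k , m ⟫) (y , from (ψ⇔u e _ y) accepts))
    ... | m′ , m′≤n , ⟪k,m⟫≡⟪k,m′⟫ =
      <⇒≱ n<m (subst (_≤ π₁ s) (sym (⟪⟫-injectiveʳ {k} {m} {k} {m′} ⟪k,m⟫≡⟪k,m′⟫)) m′≤n)

    no-overshoot : ∀ s → overshoot k s ≡ 0
    no-overshoot s with overshoot k s in eq
    ... | zero  = refl
    ... | suc _ with least-nonzero (overshoot k) s (λ ≡0 → 1+n≢0 (trans (sym eq) ≡0))
    ...   | s′ , ≢0 , below = ⊥-elim (segment-refutes s′ ≢0 below)

  𝓛-not-Sd-Bc-learnable : ¬ InTxtSdBcW ψ 𝓛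
  𝓛-not-Sd-Bc-learnable (h , learns) = stream-refutes no-overshoot
    where open Diagonal h learns

theorem11 : (ψ : Numbering) → Acceptable ψ →
    Σ Class λ 𝓛 → (∀ L → 𝓛 L → REC ψ L) × InτCIndTxtPsdExC ψ 𝓛 × ¬ InTxtSdBcW ψ 𝓛
theorem11 ψ acc = 𝓛 ψ acc , 𝓛⊆REC ψ acc , 𝓛-Psd-Ex-learnable ψ acc , 𝓛-not-Sd-Bc-learnable ψ acc
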